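{- Let $G$ be a finite connected simple undirected graph on $n$ vertices, and suppose there is a vertex $y$ with degree $n-1$. Then for any vertex $x\ne y$ of $G$, $$H(x,y)\le \max\{d_u\mid u\in\mathscr S\},$$ where $\mathscr S=\{u\in V(G)\mid \text{there is a path in } G \text{ from } x \text{ to } u \text{ not passing through } y\}$.
   Context: $d_u$ is the degree of $u$. $H(x,y)$ is the hitting time of the simple random walk on $G$ (which moves from the current vertex $v$ to each neighbor with probability $1/d_v$): the expected number of steps to reach $y$ when started from $x$. -}

module Defs where

open import Data.Nat as ℕ using (ℕ; zero; suc)
open import Data.Integer using (+_)
open import Data.Bool using (Bool; true; false; if_then_else_)
open import Data.Fin using (Fin; _≟_)
open import Relation.Nullary using (yes; no)
open import Data.Product using (Σ)
open import Data.List using (List; []; _∷_; map; foldr; allFin)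
open import Data.List.Relation.Unary.All using (All)
open import Data.Rational as ℚ using (ℚ; 0ℚ; 1ℚ; _/_)
open import Relation.Binary.PropositionalEquality using (_≡_; _≢_)

record Graph (n : ℕ) : Set where
  field
    adj    : Fin n → Fin n → Bool
    sym    : ∀ u v → adj u v ≡ adj v u
    irrefl : ∀ v → adj v v ≡ false
open Graph public

module _ {n : ℕ} (G : Graph n) where

  data Walk : Fin n → Fin n → Set where
    nil  : ∀ {u} → Walk u u
    cons : ∀ {u v w} → adj G u v ≡ true → Walk v w → Walk u w

  vertices : ∀ {u w} → Walk u w → List (Fin n)
  vertices {u} nil        = u ∷ []
  vertices {u} (cons _ p) = u ∷ vertices p

  Connected : Set
  Connected = ∀ u v → Walk u v

  degree : Fin n → ℕ
  degree v = foldr ℕ._+_ 0 (map (λ w → if adj G v w then 1 else 0) (allFin n))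

  -- 𝒮 membership: there is a walk (equivalently a path) from x to u
  -- none of whose vertices is y
  InS : Fin n → Fin n → Fin n → Set
  InS x y u = Σ (Walk x u) (λ p → All (λ z → z ≢ y) (vertices p))

  nbrSum : Fin n → (Fin n → ℚ) → ℚ
  nbrSum v f = foldr ℚ._+_ 0ℚ (map (λ w → if adj G v w then f w else 0ℚ) (allFin n))

  -- (1/d) * s, with the (irrelevant here) convention 0 when d = 0
  avg : ℕ → ℚ → ℚ
  avg zero    s = 0ℚ
  avg (suc d) s = s ℚ.* ((+ 1) / suc d)

  -- truncated hitting time: hT k y v = E_v[ min(T_y , k) ],
  -- where T_y is the hitting time of y by the simple random walk from v.
  -- (first-step recursion: E_v[min(T,k+1)] = 1 + (1/d_v) Σ_{w~v} E_w[min(T,k)] for v ≠ y)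
  hT : ℕ → Fin n → Fin n → ℚ
  hT zero    y v = 0ℚ
  hT (suc k) y v with v ≟ y
  ... | yes _ = 0ℚ
  ... | no  _ = 1ℚ ℚ.+ avg (degree v) (nbrSum v (hT k y))

{-# OPTIONS --safe #-}
module Submission where

-- Induction on the truncation level k shows E_u[min(T_y, k)] ≤ M for every u ∈ 𝒮.
-- A vertex of degree n − 1 is adjacent to every other vertex, so each u ∈ 𝒮 ∖ {y}
-- has y among its neighbours, and its other neighbours lie in 𝒮 again.  The
-- first-step equation then gives
--   E_u[min(T_y, k + 1)] ≤ 1 + (d_u − 1) M / d_u = M + 1 − M / d_u ≤ M,
-- the last step because d_u ≤ M.

open import Defs
open import Data.Nat using (ℕ; _∸_; _≤_)
open import Data.Integer using (+_)
open import Data.Fin using (Fin)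
open import Data.Rational using (_/_)
open import Relation.Binary.PropositionalEquality using (_≡_; _≢_)
import Data.Rational as Q

open import Algebra.Bundles using (CommutativeMonoid)
open import Data.Bool using (Bool; true; false; if_then_else_)
open import Data.Bool.Properties using (¬-not)
open import Data.Fin using (zero; suc; _≟_)
open import Data.Fin.Subset as Subset using (Subset; _⊂_; _⊆_; ⁅_⁆; ∁; ∣_∣)
open import Data.Fin.Subset.Properties
  using (p⊂q⇒∣p∣<∣q∣; ∣∁p∣≡n∸∣p∣; ∣⁅x⁆∣≡1; x∈p⇒∣p-x∣<∣p∣; x≢y⇒x∉⁅y⁆; x∉p⇒x∈∁p)
import Data.Integer as ℤ
import Data.Integer.Properties as ℤ
open import Data.List as List using (List; _∷_; []; map; foldr; allFin)
open import Data.Nat.ListAction using (sum)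
open import Data.List.Membership.Propositional using (_∈_)
open import Data.List.Membership.Propositional.Properties using (∈-allFin)
open import Data.List.Properties using (map-tabulate)
open import Data.List.Relation.Unary.All using (All; _∷_; [])
open import Data.List.Relation.Unary.Any using (here; there)
open import Data.Nat as ℕ using (zero; suc; z≤n; s≤s)
import Data.Nat.Properties as ℕ
open import Data.Nat.Coprimality as Coprime using (1-coprimeTo)
open import Data.Product using (_,_)
open import Data.Rational using (ℚ; 0ℚ; 1ℚ; mkℚ)
import Data.Rational.Properties as Q
import Data.Vec as Vec
open import Data.Vec.Properties using (lookup∘tabulate; lookup⇒[]=; []=⇒lookup)
open import Function using (_∘_; id)
open import Relation.Binary.PropositionalEquality as ≡ using (refl; trans; cong; subst; subst₂)
open import Relation.Nullary using (yes; no; contradiction)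

open import Algebra.Properties.CommutativeSemigroup
  (CommutativeMonoid.commutativeSemigroup Q.+-0-commutativeMonoid) using (xy∙z≈xz∙y)

fromℕ : ℕ → ℚ
fromℕ m = + m / 1

fromℕ≡mkℚ : ∀ m → fromℕ m ≡ mkℚ (+ m) 0 (Coprime.sym (1-coprimeTo m))
fromℕ≡mkℚ m = Q.normalize-coprime (Coprime.sym (1-coprimeTo m))

fromℕ-+ : ∀ m n → fromℕ (m ℕ.+ n) ≡ fromℕ m Q.+ fromℕ n
fromℕ-+ m n rewrite fromℕ≡mkℚ m | fromℕ≡mkℚ n | ℤ.*-identityʳ (+ m) | ℤ.*-identityʳ (+ n) = refl

fromℕ-mono-≤ : ∀ {m n} → m ≤ n → fromℕ m Q.≤ fromℕ n
fromℕ-mono-≤ {m} {n} m≤n rewrite fromℕ≡mkℚ m | fromℕ≡mkℚ n =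
  Q.*≤* (subst₂ ℤ._≤_ (≡.sym (ℤ.*-identityʳ (+ m))) (≡.sym (ℤ.*-identityʳ (+ n))) (ℤ.+≤+ m≤n))

fromℕ-*-1/suc : ∀ d → fromℕ (suc d) Q.* (+ 1 / suc d) ≡ 1ℚ
fromℕ-*-1/suc d rewrite fromℕ≡mkℚ (suc d) | Q.normalize-coprime {1} {d} (1-coprimeTo (suc d)) =
  Q.*-inverseʳ (mkℚ (+ suc d) 0 (Coprime.sym (1-coprimeTo (suc d))))

1+s*d⁻¹≤m : ∀ (m d r s : ℚ) .{{_ : Q.NonNegative r}} → d Q.* r ≡ 1ℚ → d Q.≤ m →
  s Q.+ m Q.≤ m Q.* d → 1ℚ Q.+ s Q.* r Q.≤ m
1+s*d⁻¹≤m m d r s dr≡1 d≤m s+m≤md = begin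
  1ℚ Q.+ s Q.* r       ≡⟨ cong (Q._+ s Q.* r) (≡.sym dr≡1) ⟩
  d Q.* r Q.+ s Q.* r  ≤⟨ Q.+-monoˡ-≤ (s Q.* r) (Q.*-monoʳ-≤-nonNeg r d≤m) ⟩
  m Q.* r Q.+ s Q.* r  ≡⟨ ≡.sym (Q.*-distribʳ-+ r m s) ⟩
  (m Q.+ s) Q.* r      ≡⟨ cong (Q._* r) (Q.+-comm m s) ⟩
  (s Q.+ m) Q.* r      ≤⟨ Q.*-monoʳ-≤-nonNeg r s+m≤md ⟩
  m Q.* d Q.* r        ≡⟨ Q.*-assoc m d r ⟩
  m Q.* (d Q.* r)      ≡⟨ cong (m Q.*_) dr≡1 ⟩
  m Q.* 1ℚ             ≡⟨ Q.*-identityʳ m ⟩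
  m                    ∎
  where open Q.≤-Reasoning

1+avg≤ : ∀ {n} (G : Graph n) {d M} (s : ℚ) → 1 ≤ d → d ≤ M →
  s Q.+ fromℕ M Q.≤ fromℕ M Q.* fromℕ d → 1ℚ Q.+ avg G d s Q.≤ fromℕ M
1+avg≤ G {suc d} s _ d≤M =
  1+s*d⁻¹≤m _ _ _ s {{Q.normalize-nonNeg 1 (suc d)}} (fromℕ-*-1/suc d) (fromℕ-mono-≤ d≤M)

sumℚ : List ℚ → ℚ
sumℚ = foldr Q._+_ 0ℚ

module _ {A : Set} {f g : A → ℚ} (f≤g : ∀ a → f a Q.≤ g a) where

  sumℚ-map-mono-≤ : ∀ xs → sumℚ (map f xs) Q.≤ sumℚ (map g xs)
  sumℚ-map-mono-≤ []       = Q.≤-refl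
  sumℚ-map-mono-≤ (a ∷ xs) = Q.+-mono-≤ (f≤g a) (sumℚ-map-mono-≤ xs)

  sumℚ-map-+-≤ : ∀ {a xs} c → a ∈ xs → f a Q.+ c Q.≤ g a →
    sumℚ (map f xs) Q.+ c Q.≤ sumℚ (map g xs)
  sumℚ-map-+-≤ {a} {_ ∷ xs} c (here refl) fa+c≤ga = begin
    f a Q.+ sumℚ (map f xs) Q.+ c  ≡⟨ xy∙z≈xz∙y (f a) _ c ⟩
    f a Q.+ c Q.+ sumℚ (map f xs)  ≤⟨ Q.+-mono-≤ fa+c≤ga (sumℚ-map-mono-≤ xs) ⟩
    g a Q.+ sumℚ (map g xs)        ∎
    where open Q.≤-Reasoning
  sumℚ-map-+-≤ {_} {b ∷ xs} c (there a∈xs) fa+c≤ga = begin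
    f b Q.+ sumℚ (map f xs) Q.+ c    ≡⟨ Q.+-assoc (f b) _ c ⟩
    f b Q.+ (sumℚ (map f xs) Q.+ c)  ≤⟨ Q.+-mono-≤ (f≤g b) (sumℚ-map-+-≤ c a∈xs fa+c≤ga) ⟩
    g b Q.+ sumℚ (map g xs)          ∎
    where open Q.≤-Reasoning

sumℚ-map-indicator : ∀ {A : Set} (b : A → Bool) c xs →
  sumℚ (map (λ a → if b a then c else 0ℚ) xs) ≡ c Q.* fromℕ (sum (map (λ a → if b a then 1 else 0) xs))
sumℚ-map-indicator b c [] = ≡.sym (Q.*-zeroʳ c)
sumℚ-map-indicator b c (a ∷ xs) with b a
... | false = trans (Q.+-identityˡ _) (sumℚ-map-indicator b c xs)
... | true  = begin
  c Q.+ sumℚ (map (λ a → if b a then c else 0ℚ) xs)  ≡⟨ cong (c Q.+_) (sumℚ-map-indicator b c xs) ⟩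
  c Q.+ c Q.* fromℕ k                                ≡⟨ cong (Q._+ c Q.* fromℕ k) (≡.sym (Q.*-identityʳ c)) ⟩
  c Q.* 1ℚ Q.+ c Q.* fromℕ k                         ≡⟨ ≡.sym (Q.*-distribˡ-+ c 1ℚ (fromℕ k)) ⟩
  c Q.* (1ℚ Q.+ fromℕ k)                             ≡⟨ cong (c Q.*_) (≡.sym (fromℕ-+ 1 k)) ⟩
  c Q.* fromℕ (suc k)                                ∎
  where
  open ≡.≡-Reasoning
  k = sum (map (λ a → if b a then 1 else 0) xs)

sum-indicator≡∣tabulate∣ : ∀ {m} (f : Fin m → Bool) →
  sum (List.tabulate (λ w → if f w then 1 else 0)) ≡ ∣ Vec.tabulate f ∣
sum-indicator≡∣tabulate∣ {zero}  f = refl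
sum-indicator≡∣tabulate∣ {suc m} f with f zero
... | true  = cong suc (sum-indicator≡∣tabulate∣ (f ∘ suc))
... | false = sum-indicator≡∣tabulate∣ (f ∘ suc)

module _ {n : ℕ} (G : Graph n) where

  neighbours : Fin n → Subset n
  neighbours v = Vec.tabulate (adj G v)

  degree≡∣neighbours∣ : ∀ v → degree G v ≡ ∣ neighbours v ∣
  degree≡∣neighbours∣ v =
    trans (cong sum (map-tabulate id (λ w → if adj G v w then 1 else 0))) (sum-indicator≡∣tabulate∣ (adj G v))

  adj⇒∈neighbours : ∀ {v w} → adj G v w ≡ true → w Subset.∈ neighbours v
  adj⇒∈neighbours {v} {w} vw = lookup⇒[]= w _ (trans (lookup∘tabulate (adj G v) w) vw)

  ∈neighbours⇒adj : ∀ {v w} → w Subset.∈ neighbours v → adj G v w ≡ true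
  ∈neighbours⇒adj {v} {w} w∈ = trans (≡.sym (lookup∘tabulate (adj G v) w)) ([]=⇒lookup w∈)

  adj⇒≢ : ∀ {v w} → adj G v w ≡ true → w ≢ v
  adj⇒≢ {v} vw refl = contradiction (trans (≡.sym vw) (irrefl G v)) λ ()

  adj⇒1≤degree : ∀ {v w} → adj G v w ≡ true → 1 ≤ degree G v
  adj⇒1≤degree {v} vw = subst (1 ≤_) (≡.sym (degree≡∣neighbours∣ v))
    (ℕ.≤-trans (s≤s z≤n) (x∈p⇒∣p-x∣<∣p∣ (adj⇒∈neighbours vw)))

  neighbours⊆∁⁅v⁆ : ∀ v → neighbours v ⊆ ∁ ⁅ v ⁆
  neighbours⊆∁⁅v⁆ v w∈ = x∉p⇒x∈∁p (x≢y⇒x∉⁅y⁆ (adj⇒≢ (∈neighbours⇒adj w∈)))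

  non-adjacent⇒degree<n∸1 : ∀ {v w} → w ≢ v → adj G v w ≡ false → degree G v ℕ.< n ∸ 1
  non-adjacent⇒degree<n∸1 {v} {w} w≢v ¬vw = begin-strict
    degree G v         ≡⟨ degree≡∣neighbours∣ v ⟩
    ∣ neighbours v ∣   <⟨ p⊂q⇒∣p∣<∣q∣ neighbours⊂∁⁅v⁆ ⟩
    ∣ ∁ ⁅ v ⁆ ∣        ≡⟨ ∣∁p∣≡n∸∣p∣ ⁅ v ⁆ ⟩
    n ∸ ∣ ⁅ v ⁆ ∣      ≡⟨ cong (n ∸_) (∣⁅x⁆∣≡1 v) ⟩
    n ∸ 1              ∎
    where
    open ℕ.≤-Reasoning
    neighbours⊂∁⁅v⁆ : neighbours v ⊂ ∁ ⁅ v ⁆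
    neighbours⊂∁⁅v⁆ = neighbours⊆∁⁅v⁆ v , w , x∉p⇒x∈∁p (x≢y⇒x∉⁅y⁆ w≢v) ,
      λ w∈ → contradiction (trans (≡.sym ¬vw) (∈neighbours⇒adj w∈)) λ ()

  degree≡n∸1⇒adj : ∀ {y} → degree G y ≡ n ∸ 1 → ∀ {u} → u ≢ y → adj G u y ≡ true
  degree≡n∸1⇒adj {y} dy {u} u≢y = trans (Graph.sym G u y)
    (¬-not λ ¬yu → ℕ.<⇒≢ (non-adjacent⇒degree<n∸1 u≢y ¬yu) dy)

  _▷_ : ∀ {a b c} → Walk G a b → adj G b c ≡ true → Walk G a c
  nil      ▷ e = cons e nil
  cons e′ p ▷ e = cons e′ (p ▷ e)

  All-vertices-▷ : ∀ {P : Fin n → Set} {a b c} (p : Walk G a b) (e : adj G b c ≡ true) →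
    All P (vertices G p) → P c → All P (vertices G (p ▷ e))
  All-vertices-▷ nil        e (Pa ∷ []) Pc = Pa ∷ Pc ∷ []
  All-vertices-▷ (cons _ p) e (Pa ∷ Ps) Pc = Pa ∷ All-vertices-▷ p e Ps Pc

  InS-extend : ∀ {x y u w} → InS G x y u → adj G u w ≡ true → w ≢ y → InS G x y w
  InS-extend (p , p∌y) uw w≢y = p ▷ uw , All-vertices-▷ p uw p∌y w≢y

  hT-target : ∀ k y → hT G k y y ≡ 0ℚ
  hT-target zero    y = refl
  hT-target (suc k) y with y ≟ y
  ... | yes _   = refl
  ... | no  y≢y = contradiction refl y≢y

  nbrSum-≤ : ∀ {u y} (m : ℚ) (h : Fin n → ℚ) → 0ℚ Q.≤ m → adj G u y ≡ true → h y ≡ 0ℚ →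
    (∀ w → adj G u w ≡ true → w ≢ y → h w Q.≤ m) →
    nbrSum G u h Q.+ m Q.≤ m Q.* fromℕ (degree G u)
  nbrSum-≤ {u} {y} m h 0≤m uy hy h≤m = begin
    nbrSum G u h Q.+ m        ≤⟨ sumℚ-map-+-≤ f≤g m (∈-allFin y) fy+m≤gy ⟩
    sumℚ (map g (allFin n))   ≡⟨ sumℚ-map-indicator (adj G u) m (allFin n) ⟩
    m Q.* fromℕ (degree G u)  ∎
    where
    open Q.≤-Reasoning
    f g : Fin n → ℚ
    f w = if adj G u w then h w else 0ℚ
    g w = if adj G u w then m else 0ℚ
    f≤g : ∀ w → f w Q.≤ g w
    f≤g w with adj G u w in uw | w ≟ y
    ... | false | _        = Q.≤-refl
    ... | true  | yes refl = subst (Q._≤ m) (≡.sym hy) 0≤m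
    ... | true  | no w≢y   = h≤m w uw w≢y
    fy+m≤gy : f y Q.+ m Q.≤ g y
    fy+m≤gy rewrite uy | hy = Q.≤-reflexive (Q.+-identityˡ m)

module _ {n : ℕ} (G : Graph n) {x y : Fin n} (y-universal : ∀ {u} → u ≢ y → adj G u y ≡ true)
         {M : ℕ} (degree≤M : ∀ u → InS G x y u → degree G u ≤ M) where

  0≤M : 0ℚ Q.≤ fromℕ M
  0≤M = fromℕ-mono-≤ {0} {M} z≤n

  hT≤M : ∀ k u → InS G x y u → hT G k y u Q.≤ fromℕ M
  hT≤M zero    u _   = 0≤M
  hT≤M (suc k) u u∈S with u ≟ y
  ... | yes _   = 0≤M
  ... | no  u≢y = 1+avg≤ G {M = M} _ (adj⇒1≤degree G uy) (degree≤M u u∈S)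
                    (nbrSum-≤ G (fromℕ M) (hT G k y) 0≤M uy (hT-target G k y) neighbours≤M)
    where
    uy = y-universal u≢y
    neighbours≤M : ∀ w → adj G u w ≡ true → w ≢ y → hT G k y w Q.≤ fromℕ M
    neighbours≤M w uw w≢y = hT≤M k w (InS-extend G u∈S uw w≢y)

corollary2p12 : (n : ℕ) (G : Graph n) → Connected G →
    (y : Fin n) → degree G y ≡ n ∸ 1 →
    (x : Fin n) → x ≢ y →
    (M : ℕ) → (∀ u → InS G x y u → degree G u ≤ M) →
    ∀ k → hT G k y x Q.≤ (+ M) / 1
corollary2p12 n G _ y dy x x≢y M degree≤M k =
  hT≤M G (degree≡n∸1⇒adj G dy) degree≤M k x (nil , x≢y ∷ [])
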